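{- Let $A$ be a finite set of real numbers and let $D=\{d_1<d_2<\dots<d_{|D|}\}$ be the set of positive elements of $A-A$. Let $a,a'\in A$ with $a'<a$, and let $Z$ be a positive integer with $Z\le |D|$. If $|(A+A-A)\cap(a',a]|\le Z$, then $a-a'\le d_Z$.
   Context: $A-A=\{x-y:x,y\in A\}$ and $A+A-A=\{a_1+a_2-a_3:a_1,a_2,a_3\in A\}$. -}

module Defs where

open import Level using (Level; _⊔_) renaming (suc to lsuc)
open import Algebra.Core using (Op₁; Op₂)
open import Algebra.Structures using (IsAbelianGroup)
open import Relation.Binary.Core using (Rel)
open import Relation.Binary.Structures using (IsStrictTotalOrder)
open import Relation.Binary.PropositionalEquality using (_≡_)
open import Data.Product using (∃; _×_)
open import Data.Sum using (_⊎_)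
open import Data.Nat using (ℕ; _≤_)
open import Data.Fin as Fin using (Fin)
open import Data.List using (List; length)
open import Data.List.Membership.Propositional using (_∈_)
open import Data.List.Relation.Unary.All using (All)
open import Data.List.Relation.Unary.Unique.Propositional using (Unique)

-- A totally ordered abelian group (with propositional equality).
-- The real numbers (ℝ, +, 0, -, <) are an instance; agda-stdlib has no reals.
record OrderedAbelianGroup (c ℓ : Level) : Set (lsuc (c ⊔ ℓ)) where
  infixl 6 _+_ _-_
  infix 4 _<_ _≤ᵍ_
  field
    Carrier            : Set c
    _+_                : Op₂ Carrier
    0#                 : Carrier
    -_                 : Op₁ Carrier
    _<_                : Rel Carrier ℓ
    isAbelianGroup     : IsAbelianGroup _≡_ _+_ 0# -_
    isStrictTotalOrder : IsStrictTotalOrder _≡_ _<_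
    +-mono-<           : ∀ {x y} z → x < y → x + z < y + z

  _-_ : Op₂ Carrier
  x - y = x + (- y)

  _≤ᵍ_ : Rel Carrier (c ⊔ ℓ)
  x ≤ᵍ y = x < y ⊎ x ≡ y

module _ {c ℓ : Level} (G : OrderedAbelianGroup c ℓ) where
  open OrderedAbelianGroup G

  PosDiff : List Carrier → Carrier → Set (c ⊔ ℓ)
  PosDiff A d = ∃ λ x → ∃ λ y → x ∈ A × y ∈ A × d ≡ x - y × 0# < d

  InAApAmA : List Carrier → Carrier → Set c
  InAApAmA A s = ∃ λ a₁ → ∃ λ a₂ → ∃ λ a₃ →
    a₁ ∈ A × a₂ ∈ A × a₃ ∈ A × s ≡ a₁ + a₂ - a₃

  IsIncreasingEnumeration : ∀ {p} (P : Carrier → Set p) (n : ℕ) → (Fin n → Carrier) → Set (c ⊔ ℓ ⊔ p)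
  IsIncreasingEnumeration P n d =
    (∀ i j → i Fin.< j → d i < d j) × (∀ i → P (d i)) × (∀ x → P x → ∃ λ i → d i ≡ x)

  CardLe : ∀ {p} (P : Carrier → Set p) → ℕ → Set (c ⊔ p)
  CardLe P n = ∀ (L : List Carrier) → Unique L → All P L → length L ≤ n

-- If d_Z < a - a', then a together with a - d₁ > a - d₂ > … > a - d_Z gives Z + 1
-- distinct elements of (A + A - A) ∩ (a', a]: writing dᵢ = x - y with x, y ∈ A,
-- a - dᵢ = a + y - x, and dᵢ ≤ d_Z < a - a' places it above a'.
-- The enumeration d is indexed from 0, so Z = k + 1 and d_Z = d (fromℕ< k<n).
module Submission where

open import Defs
open import Level using (Level; _⊔_)
open import Function using (_∘_)
open import Data.Nat using (ℕ; suc; s≤s⁻¹) renaming (_≤_ to _≤ℕ_; _<_ to _<ℕ_)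
import Data.Nat.Properties as ℕ
open import Data.Fin as Fin using (Fin; fromℕ<; inject≤; toℕ)
open import Data.Fin.Properties using (<-cmp; toℕ-injective; toℕ<n; toℕ-fromℕ<; toℕ-inject≤)
open import Data.Product using (_×_; _,_)
open import Data.Sum using (_⊎_; inj₁; inj₂; fromInj₁)
open import Data.Empty using (⊥-elim)
open import Data.List using (List; _∷_; tabulate)
open import Data.List.Properties using (length-tabulate)
open import Data.List.Membership.Propositional using (_∈_)
open import Data.List.Relation.Unary.All using (All; _∷_)
import Data.List.Relation.Unary.All.Properties as All
open import Data.List.Relation.Unary.AllPairs using (_∷_)
open import Data.List.Relation.Unary.Unique.Propositional using (Unique)
import Data.List.Relation.Unary.Unique.Propositional.Properties as Unique
open import Relation.Nullary using (¬_)
open import Relation.Binary.PropositionalEquality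
open import Relation.Binary.Definitions using (tri<; tri≈; tri>)
open import Relation.Binary.Structures using (IsStrictTotalOrder)
open import Algebra.Bundles using (AbelianGroup)
open import Algebra.Structures using (IsAbelianGroup)
import Algebra.Properties.AbelianGroup as AbelianGroupProperties

module OrderedAbelianGroupProperties {c ℓ : Level} (G : OrderedAbelianGroup c ℓ) where
  open OrderedAbelianGroup G
  open IsAbelianGroup isAbelianGroup using (assoc; comm; identityʳ)
  open IsStrictTotalOrder isStrictTotalOrder
    using (compare) renaming (irrefl to <-irrefl; trans to <-trans)

  abelianGroup : AbelianGroup c c
  abelianGroup = record { isAbelianGroup = isAbelianGroup }

  open AbelianGroupProperties abelianGroup
    using ( ε⁻¹≈ε; ⁻¹-injective; ⁻¹-anti-homo‿-; ∙-cancelˡ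
          ; \\-leftDividesˡ; //-rightDividesˡ; //-rightDividesʳ )

  x-0≡x : ∀ x → x - 0# ≡ x
  x-0≡x x = trans (cong (x +_) ε⁻¹≈ε) (identityʳ x)

  x-[x-y]≡y : ∀ x y → x - (x - y) ≡ y
  x-[x-y]≡y x y = begin
    x + - (x - y) ≡⟨ cong (x +_) (⁻¹-anti-homo‿- x y) ⟩
    x + (y - x)   ≡⟨ comm x (y - x) ⟩
    (y - x) + x   ≡⟨ //-rightDividesˡ x y ⟩
    y             ∎
    where open ≡-Reasoning

  x-[y-z]≡[x+z]-y : ∀ x y z → x - (y - z) ≡ (x + z) - y
  x-[y-z]≡[x+z]-y x y z = begin
    x + - (y - z) ≡⟨ cong (x +_) (⁻¹-anti-homo‿- y z) ⟩
    x + (z - y)   ≡⟨ assoc x z (- y) ⟨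
    (x + z) - y   ∎
    where open ≡-Reasoning

  x-y≡x-z⇒y≡z : ∀ {x y z} → x - y ≡ x - z → y ≡ z
  x-y≡x-z⇒y≡z {x} {y} {z} eq = ⁻¹-injective (∙-cancelˡ x (- y) (- z) eq)

  +-monoʳ-< : ∀ {x y} z → x < y → z + x < z + y
  +-monoʳ-< {x} {y} z x<y = subst₂ _<_ (comm x z) (comm y z) (+-mono-< z x<y)

  -‿anti-< : ∀ {x y} → x < y → - y < - x
  -‿anti-< {x} {y} x<y = subst₂ _<_ (\\-leftDividesˡ x (- y)) y-x-y≡-x (+-mono-< (- x + - y) x<y)
    where
    y-x-y≡-x : y + (- x + - y) ≡ - x
    y-x-y≡-x = trans (cong (y +_) (comm (- x) (- y))) (\\-leftDividesˡ y (- x))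

  -‿monoʳ-< : ∀ {x y} z → x < y → z - y < z - x
  -‿monoʳ-< z = +-monoʳ-< z ∘ -‿anti-<

  0<y⇒x-y<x : ∀ {y} x → 0# < y → x - y < x
  0<y⇒x-y<x x 0<y = subst (x - _ <_) (x-0≡x x) (-‿monoʳ-< x 0<y)

  y<x-z⇒z<x-y : ∀ {x y z} → y < x - z → z < x - y
  y<x-z⇒z<x-y {x} {y} {z} y<x-z = subst (_< x - y) (x-[x-y]≡y x z) (-‿monoʳ-< x y<x-z)

  ≤ᵍ⊎> : ∀ x y → x ≤ᵍ y ⊎ y < x
  ≤ᵍ⊎> x y with compare x y
  ... | tri< x<y _ _ = inj₁ (inj₁ x<y)
  ... | tri≈ _ x≡y _ = inj₁ (inj₂ x≡y)
  ... | tri> _ _ y<x = inj₂ y<x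

  ≤ᵍ-<-trans : ∀ {x y z} → x ≤ᵍ y → y < z → x < z
  ≤ᵍ-<-trans (inj₁ x<y) y<z = <-trans x<y y<z
  ≤ᵍ-<-trans (inj₂ refl) y<z = y<z

  StrictlyIncreasing : ∀ {m} → (Fin m → Carrier) → Set ℓ
  StrictlyIncreasing f = ∀ i j → i Fin.< j → f i < f j

  strictlyIncreasing⇒injective : ∀ {m} {f : Fin m → Carrier} → StrictlyIncreasing f →
    ∀ {i j} → f i ≡ f j → i ≡ j
  strictlyIncreasing⇒injective f↑ {i} {j} fi≡fj with <-cmp i j
  ... | tri< i<j _ _ = ⊥-elim (<-irrefl fi≡fj (f↑ i j i<j))
  ... | tri≈ _ i≡j _ = i≡j
  ... | tri> _ _ j<i = ⊥-elim (<-irrefl (sym fi≡fj) (f↑ j i j<i))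

  strictlyIncreasing-inject≤ : ∀ {m n} {f : Fin n → Carrier} .(m≤n : m ≤ℕ n) →
    StrictlyIncreasing f → StrictlyIncreasing (λ i → f (inject≤ i m≤n))
  strictlyIncreasing-inject≤ m≤n f↑ i j i<j =
    f↑ _ _ (subst₂ _<ℕ_ (sym (toℕ-inject≤ i m≤n)) (sym (toℕ-inject≤ j m≤n)) i<j)

  strictlyIncreasing-inject≤-≤-fromℕ< : ∀ {k n} {f : Fin n → Carrier} (k<n : k <ℕ n) →
    StrictlyIncreasing f → ∀ i → f (inject≤ i k<n) ≤ᵍ f (fromℕ< k<n)
  strictlyIncreasing-inject≤-≤-fromℕ< {f = f} k<n f↑ i
    with ℕ.m≤n⇒m<n∨m≡n (s≤s⁻¹ (toℕ<n i))
  ... | inj₁ i<k = inj₁ (f↑ _ _ (subst₂ _<ℕ_ (sym (toℕ-inject≤ i k<n)) (sym (toℕ-fromℕ< k<n)) i<k))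
  ... | inj₂ i≡k = inj₂ (cong f (toℕ-injective (begin
    toℕ (inject≤ i k<n) ≡⟨ toℕ-inject≤ i k<n ⟩
    toℕ i               ≡⟨ i≡k ⟩
    _                   ≡⟨ toℕ-fromℕ< k<n ⟨
    toℕ (fromℕ< k<n)    ∎)))
    where open ≡-Reasoning

  AApAmA-between : List Carrier → Carrier → Carrier → Carrier → Set (c ⊔ ℓ)
  AApAmA-between A a' a s = InAApAmA G A s × a' < s × s ≤ᵍ a

  PosDiff⇒0< : ∀ {A e} → PosDiff G A e → 0# < e
  PosDiff⇒0< (_ , _ , _ , _ , _ , 0<e) = 0<e

  module _ {A : List Carrier} {a : Carrier} (a∈A : a ∈ A) where

    ∈⇒∈AApAmA : InAApAmA G A a
    ∈⇒∈AApAmA = a , a , a , a∈A , a∈A , a∈A , sym (//-rightDividesʳ a a)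

    -PosDiff∈AApAmA : ∀ {e} → PosDiff G A e → InAApAmA G A (a - e)
    -PosDiff∈AApAmA (x , y , x∈A , y∈A , refl , _) =
      a , y , x , a∈A , y∈A , x∈A , x-[y-z]≡[x+z]-y a x y

    -PosDiff∈AApAmA-between : ∀ {a' e} → PosDiff G A e → e < a - a' →
      AApAmA-between A a' a (a - e)
    -PosDiff∈AApAmA-between e∈D e<a-a' =
      -PosDiff∈AApAmA e∈D , y<x-z⇒z<x-y e<a-a' , inj₁ (0<y⇒x-y<x a (PosDiff⇒0< e∈D))

  ¬CardLe-AApAmA-between : ∀ {A n} {d : Fin n → Carrier} →
    IsIncreasingEnumeration G (PosDiff G A) n d →
    ∀ {a a'} → a ∈ A → a' < a → ∀ {k} (k<n : k <ℕ n) → d (fromℕ< k<n) < a - a' →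
    ¬ CardLe G (AApAmA-between A a' a) (suc k)
  ¬CardLe-AApAmA-between {A = A} {d = d} (d↑ , d∈D , _) {a} {a'} a∈A a'<a {k} k<n dₖ<a-a' card =
    ℕ.<-irrefl refl (subst (λ m → suc m ≤ℕ suc k) (length-tabulate a-dᵢ)
                           (card (a ∷ tabulate a-dᵢ) unique between))
    where
    dᵢ : Fin (suc k) → Carrier
    dᵢ i = d (inject≤ i k<n)

    a-dᵢ : Fin (suc k) → Carrier
    a-dᵢ i = a - dᵢ i

    dᵢ<a-a' : ∀ i → dᵢ i < a - a'
    dᵢ<a-a' i = ≤ᵍ-<-trans (strictlyIncreasing-inject≤-≤-fromℕ< k<n d↑ i) dₖ<a-a'

    a-dᵢ<a : ∀ i → a-dᵢ i < a
    a-dᵢ<a i = 0<y⇒x-y<x a (PosDiff⇒0< (d∈D _))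

    unique : Unique (a ∷ tabulate a-dᵢ)
    unique = All.tabulate⁺ (λ i a≡a-dᵢ → <-irrefl (sym a≡a-dᵢ) (a-dᵢ<a i))
           ∷ Unique.tabulate⁺ (dᵢ-injective ∘ x-y≡x-z⇒y≡z)
      where dᵢ-injective = strictlyIncreasing⇒injective (strictlyIncreasing-inject≤ k<n d↑)

    between : All (AApAmA-between A a' a) (a ∷ tabulate a-dᵢ)
    between = (∈⇒∈AApAmA a∈A , a'<a , inj₂ refl)
            ∷ All.tabulate⁺ (λ i → -PosDiff∈AApAmA-between a∈A (d∈D _) (dᵢ<a-a' i))

lemma2p3 : ∀ {c ℓ} (G : OrderedAbelianGroup c ℓ) → let open OrderedAbelianGroup G in
    (A : List Carrier) (n : ℕ) (d : Fin n → Carrier) →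
    IsIncreasingEnumeration G (PosDiff G A) n d →
    (a a' : Carrier) → a ∈ A → a' ∈ A → a' < a →
    (k : ℕ) (k<n : k <ℕ n) →
    CardLe G (λ s → InAApAmA G A s × a' < s × s ≤ᵍ a) (suc k) →
    a - a' ≤ᵍ d (fromℕ< k<n)
lemma2p3 G A n d d-enum a a' a∈A _ a'<a k k<n card =
  fromInj₁ (λ dₖ<a-a' → ⊥-elim (¬CardLe-AApAmA-between d-enum a∈A a'<a k<n dₖ<a-a' card))
           (≤ᵍ⊎> (a - a') (d (fromℕ< k<n)))
  where open OrderedAbelianGroup G
        open OrderedAbelianGroupProperties G
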